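{- (i) $\langle -,sw\rangle=\{f\in\mathrm{Sym}(D): f=g$ or $f=-\circ g$ for some $g\in\langle sw\rangle\}$. (ii) $\langle -,rot\rangle=\{f\in\mathrm{Sym}(D): f=g$ or $f=-\circ g$ for some $g\in\langle rot\rangle\}$.
   Context: $(D,E)$ is the generic digraph: the unique up to isomorphism countable homogeneous digraph (irreflexive antisymmetric edge relation $E$) into which every finite digraph embeds. $N(x,y)$ means $\neg E(x,y)\wedge\neg E(y,x)$. $\mathrm{Sym}(D)$ has the topology of pointwise convergence, and $\langle F\rangle$ denotes the smallest closed subgroup containing $\mathrm{Aut}(D,E)\cup F$. Fixed permutations: $-$ with $E(-(x),-(y))\iff E(y,x)$; for fixed $a\in D$, $sw$ with, for distinct $x,y$, $E(sw(x),sw(y))$ iff ($x,y\ne a$ and $E(x,y)$) or ($a\in\{x,y\}$ and $E(y,x)$); for fixed $a\in D$, $rot$ with, for distinct $x,y$, $E(rot(x),rot(y))$ iff ($x,y\ne a$ and $E(x,y)$) or ($x=a$ and $N(x,y)$) or ($y=a$ and $E(y,x)$). -}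

module Defs where

open import Level using (0ℓ)
open import Data.Nat using (ℕ)
open import Data.Fin using (Fin)
open import Data.List using (List)
open import Data.List.Relation.Unary.All using (All)
open import Data.Product using (Σ; ∃; _×_; _,_)
open import Data.Sum using (_⊎_)
open import Relation.Nullary using (¬_)
open import Relation.Binary.PropositionalEquality using (_≡_; _≢_)
open import Function.Bundles using (_⇔_; _↣_)
open import Function.Definitions using (Injective)

record Perm (D : Set) : Set where
  field
    to        : D → D
    from      : D → D
    to-from   : ∀ x → to (from x) ≡ x
    from-to   : ∀ x → from (to x) ≡ x
open Perm public

module _ {D : Set} where

  idP : Perm D
  idP = record { to = λ x → x ; from = λ x → x
               ; to-from = λ _ → _≡_.refl ; from-to = λ _ → _≡_.refl }

  _∘P_ : Perm D → Perm D → Perm D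
  f ∘P g = record
    { to = λ x → to f (to g x)
    ; from = λ x → from g (from f x)
    ; to-from = λ x → helper₁ x
    ; from-to = λ x → helper₂ x }
    where
    open import Relation.Binary.PropositionalEquality using (cong; trans)
    helper₁ : ∀ x → to f (to g (from g (from f x))) ≡ x
    helper₁ x = trans (cong (to f) (to-from g (from f x))) (to-from f x)
    helper₂ : ∀ x → from g (from f (to f (to g x))) ≡ x
    helper₂ x = trans (cong (from g) (from-to f (to g x))) (from-to g x)

  _⁻¹P : Perm D → Perm D
  f ⁻¹P = record { to = from f ; from = to f
                 ; to-from = from-to f ; from-to = to-from f }

  _≈P_ : Perm D → Perm D → Set
  f ≈P g = ∀ x → to f x ≡ to g x

module _ {D : Set} (E : D → D → Set) where

  IsDigraph : Set
  IsDigraph = (∀ x → ¬ E x x) × (∀ x y → E x y → ¬ E y x)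

  N : D → D → Set
  N x y = ¬ E x y × ¬ E y x

  IsAut : Perm D → Set
  IsAut α = ∀ x y → E x y ⇔ E (to α x) (to α y)

  -- homogeneity: every isomorphism between finite induced substructures
  -- (enumerated injectively by u and v) extends to an automorphism
  Homogeneous : Set
  Homogeneous = ∀ (n : ℕ) (u v : Fin n → D) → Injective _≡_ _≡_ u → Injective _≡_ _≡_ v →
    (∀ i j → E (u i) (u j) ⇔ E (v i) (v j)) →
    Σ (Perm D) λ α → IsAut α × (∀ i → to α (u i) ≡ v i)

  Universal : Set₁
  Universal = ∀ (n : ℕ) (R : Fin n → Fin n → Set) →
    (∀ i → ¬ R i i) → (∀ i j → R i j → ¬ R j i) →
    Σ (Fin n → D) λ u → Injective _≡_ _≡_ u × (∀ i j → R i j ⇔ E (u i) (u j))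

  IsGenericDigraph : Set₁
  IsGenericDigraph = (D ↣ ℕ) × IsDigraph × Homogeneous × Universal

  IsMinus : Perm D → Set
  IsMinus m = ∀ x y → E (to m x) (to m y) ⇔ E y x

  IsSw : D → Perm D → Set
  IsSw a s = ∀ x y → x ≢ y →
    E (to s x) (to s y) ⇔ ((x ≢ a × y ≢ a × E x y) ⊎ ((x ≡ a ⊎ y ≡ a) × E y x))

  IsRot : D → Perm D → Set
  IsRot a r = ∀ x y → x ≢ y →
    E (to r x) (to r y) ⇔ ((x ≢ a × y ≢ a × E x y) ⊎ (x ≡ a × N x y) ⊎ (y ≡ a × E y x))

module _ {D : Set} where

  -- P is closed in Sym(D): f is in P whenever every basic open
  -- neighbourhood {g | g x = f x for x ∈ xs} of f meets P
  IsClosed : (Perm D → Set) → Set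
  IsClosed P = ∀ f → (∀ (xs : List D) → Σ (Perm D) λ g → P g × All (λ x → to g x ≡ to f x) xs) → P f

  IsSubgroup : (Perm D → Set) → Set
  IsSubgroup P = P idP × (∀ f g → P f → P g → P (f ∘P g)) × (∀ f → P f → P (f ⁻¹P))

  IsClosedSubgroup : (Perm D → Set) → Set
  IsClosedSubgroup P = IsSubgroup P × IsClosed P

  -- ⟨ F ⟩ : the smallest closed subgroup containing Aut(D,E) ∪ F,
  -- i.e. the intersection of all such closed subgroups
  ⟨_⟩ : (E : D → D → Set) → (Perm D → Set) → Perm D → Set₁
  ⟨ E ⟩ F f = ∀ (P : Perm D → Set) → IsClosedSubgroup P →
    (∀ α → IsAut E α → P α) → (∀ h → F h → P h) → P f

module Submission where

-- Plan.  (1) ⟨ F ⟩ is the least closed subgroup containing Aut ∪ F; with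
-- excluded middle for Set₁ this gives an induction principle, and the union of
-- two closed sets is closed.  (2) Adjoining an anti-automorphism m: if every
-- generator h ∈ F has m⁻¹ h m ∈ ⟨ F ⟩, then ⟨ F ⟩ is normalised by m, and since
-- m ∘ m is an automorphism, H ∪ m H (H = ⟨ F ⟩) is a closed subgroup containing
-- Aut, m and F; hence ⟨ m, F ⟩ = H ∪ m H.  (3) The digraph-specific input is
-- m⁻¹ s m ∈ ⟨ s ⟩.  We record how a permutation alters the edges at a single
-- point b (AlteredAt); two permutations altering the edges at b the same way
-- differ by an automorphism, so one lies in ⟨ F ⟩ iff the other does.  With
-- m b = a and an automorphism β with β b = a (homogeneity), both m⁻¹ sw m and
-- β⁻¹ sw β are switches at b; with β b = rot a, both m⁻¹ rot m and
-- β⁻¹ rot⁻¹ β are counter-rotations at b.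

open import Defs
open import Level using (0ℓ)
open import Axiom.ExcludedMiddle using (ExcludedMiddle)
open import Data.Product using (Σ; _×_; _,_; proj₁; proj₂)
open import Data.Sum using (_⊎_; inj₁; inj₂)
open import Data.Unit using (⊤; tt)
open import Data.Empty using (⊥; ⊥-elim)
open import Data.Fin using (zero)
open import Data.List using (List; _++_; map)
open import Data.List.Relation.Unary.All using (All; universal)
import Data.List.Relation.Unary.All as All
open import Data.List.Relation.Unary.All.Properties using (++⁻; map⁻)
open import Relation.Nullary using (¬_; Dec; yes; no)
open import Relation.Binary.PropositionalEquality
  using (_≡_; _≢_; refl; sym; trans; cong; module ≡-Reasoning)
open import Function.Bundles using (_⇔_; mk⇔; Equivalence)
open import Function.Properties.Equivalence using ()
  renaming (refl to ⇔-refl; sym to ⇔-sym; trans to ⇔-trans)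
open import Function.Related.TypeIsomorphisms using (¬-cong-⇔)
open import Data.Product.Function.NonDependent.Propositional using (_×-⇔_)
open import Function.Related.Propositional using (module EquationalReasoning; equivalence)
module ⇔-Reasoning = EquationalReasoning {k = equivalence}
open Equivalence using () renaming (to to forth; from to back)

-- Excluded middle for Set₁ lets us replace a proposition in Set₁ by an
-- equivalent one in Set; this is needed to instantiate the impredicative
-- definition of ⟨ F ⟩ with predicates of size Set₁.
Lower : {A : Set₁} → Dec A → Set
Lower (yes _) = ⊤
Lower (no _)  = ⊥

lower : {A : Set₁} (d : Dec A) → A → Lower d
lower (yes _) _ = tt
lower (no ¬a) a = ¬a a

raise : {A : Set₁} (d : Dec A) → Lower d → A
raise (yes a) _ = a

module _ {D : Set} where

  conjBy : Perm D → Perm D → Perm D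
  conjBy β g = (β ⁻¹P) ∘P (g ∘P β)

  to-injective : (f : Perm D) {x y : D} → to f x ≡ to f y → x ≡ y
  to-injective f {x} {y} e = trans (sym (from-to f x)) (trans (cong (from f) e) (from-to f y))

  from-injective : (f : Perm D) {x y : D} → from f x ≡ from f y → x ≡ y
  from-injective f = to-injective (f ⁻¹P)

  off-point : (f : Perm D) {a b x : D} → to f b ≡ a → x ≢ b → to f x ≢ a
  off-point f fb≡a x≢b fx≡a = x≢b (to-injective f (trans fx≡a (sym fb≡a)))

  Meets : (Perm D → Set₁) → Perm D → List D → Set₁
  Meets C f xs = Σ (Perm D) λ g → C g × All (λ x → to g x ≡ to f x) xs

  IsClosed₁ : (Perm D → Set₁) → Set₁
  IsClosed₁ C = ∀ f → (∀ xs → Meets C f xs) → C f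

  IsClosedSubgroup₁ : (Perm D → Set₁) → Set₁
  IsClosedSubgroup₁ C =
    (C idP × (∀ f g → C f → C g → C (f ∘P g)) × (∀ f → C f → C (f ⁻¹P))) × IsClosed₁ C

  separate : ExcludedMiddle (Level.suc 0ℓ) → (C : Perm D → Set₁) → IsClosed₁ C →
    ∀ f → ¬ C f → Σ (List D) λ xs → ¬ Meets C f xs
  separate lem C closed f ¬Cf with lem {Σ (List D) λ xs → ¬ Meets C f xs}
  ... | yes found = found
  ... | no none = ⊥-elim (¬Cf (closed f meets))
    where
    meets : ∀ xs → Meets C f xs
    meets xs with lem {Meets C f xs}
    ... | yes m = m
    ... | no ¬m = ⊥-elim (none (xs , ¬m))

  union-closed : ExcludedMiddle (Level.suc 0ℓ) → (A B : Perm D → Set₁) →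
    IsClosed₁ A → IsClosed₁ B → IsClosed₁ (λ f → A f ⊎ B f)
  union-closed lem A B closedA closedB f meets with lem {A f} | lem {B f}
  ... | yes Af | _ = inj₁ Af
  ... | no _ | yes Bf = inj₂ Bf
  ... | no ¬Af | no ¬Bf with separate lem A closedA f ¬Af | separate lem B closedB f ¬Bf
  ... | xs , ¬meetsA | ys , ¬meetsB with meets (xs ++ ys)
  ... | g , inj₁ Ag , agree = ⊥-elim (¬meetsA (g , Ag , proj₁ (++⁻ xs agree)))
  ... | g , inj₂ Bg , agree = ⊥-elim (¬meetsB (g , Bg , proj₂ (++⁻ xs agree)))

module Edges {D : Set} (E : D → D → Set) where

  E-cong : ∀ {x x' y y'} → x ≡ x' → y ≡ y' → E x y ⇔ E x' y'
  E-cong refl refl = ⇔-refl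

  N-cong : ∀ {x x' y y'} → E x y ⇔ E x' y' → E y x ⇔ E y' x' → N E x y ⇔ N E x' y'
  N-cong e e' = ¬-cong-⇔ e ×-⇔ ¬-cong-⇔ e'

  aut-inverse : (α : Perm D) → IsAut E α → ∀ x y → E (from α x) (from α y) ⇔ E x y
  aut-inverse α α-aut x y = ⇔-trans (α-aut (from α x) (from α y)) (E-cong (to-from α x) (to-from α y))

  anti-inverse : (m : Perm D) → IsMinus E m → ∀ x y → E (from m x) (from m y) ⇔ E y x
  anti-inverse m m-anti x y =
    ⇔-trans (⇔-sym (m-anti (from m y) (from m x))) (E-cong (to-from m y) (to-from m x))

  anti²-aut : (m : Perm D) → IsMinus E m → IsAut E (m ∘P m)
  anti²-aut m m-anti x y = ⇔-sym (⇔-trans (m-anti (to m x) (to m y)) (m-anti y x))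

  anti-conj-aut : (m α : Perm D) → IsMinus E m → IsAut E α → IsAut E (conjBy m α)
  anti-conj-aut m α m-anti α-aut x y = begin
    E x y                                               ∼⟨ ⇔-sym (m-anti y x) ⟩
    E (to m y) (to m x)                                 ∼⟨ α-aut (to m y) (to m x) ⟩
    E (to α (to m y)) (to α (to m x))                   ∼⟨ ⇔-sym (anti-inverse m m-anti _ _) ⟩
    E (from m (to α (to m x))) (from m (to α (to m y))) ∎
    where open ⇔-Reasoning

  same-type-aut : (∀ x → ¬ E x x) → (p q : Perm D) →
    (∀ x y → x ≢ y → E (to p x) (to p y) ⇔ E (to q x) (to q y)) → IsAut E (p ∘P (q ⁻¹P))
  same-type-aut irr p q same x y = mk⇔
    (λ e → back (via (λ x≡y → distinct e (from-injective q x≡y))) e)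
    (λ e → forth (via (λ x≡y → distinct e (cong (to p) x≡y))) e)
    where
    distinct : ∀ {u v} → E u v → u ≢ v
    distinct e refl = irr _ e
    via : from q x ≢ from q y → E (to p (from q x)) (to p (from q y)) ⇔ E x y
    via ne = ⇔-trans (same (from q x) (from q y) ne) (E-cong (to-from q x) (to-from q y))

module Generated {D : Set} (E : D → D → Set) (F : Perm D → Set) where
  open Edges E

  G : Perm D → Set₁
  G = ⟨ E ⟩ F

  G-aut : ∀ α → IsAut E α → G α
  G-aut α α-aut P _ aut⊆P _ = aut⊆P α α-aut

  G-gen : ∀ h → F h → G h
  G-gen h Fh P _ _ F⊆P = F⊆P h Fh

  G-id : G idP
  G-id P ((Pid , _ , _) , _) _ _ = Pid

  G-∘ : ∀ {f g} → G f → G g → G (f ∘P g)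
  G-∘ {f} {g} Gf Gg P cs@((_ , P∘ , _) , _) aut⊆P F⊆P =
    P∘ f g (Gf P cs aut⊆P F⊆P) (Gg P cs aut⊆P F⊆P)

  G-⁻¹ : ∀ {f} → G f → G (f ⁻¹P)
  G-⁻¹ {f} Gf P cs@((_ , _ , P⁻¹) , _) aut⊆P F⊆P = P⁻¹ f (Gf P cs aut⊆P F⊆P)

  G-closed : IsClosed₁ G
  G-closed f meets P cs aut⊆P F⊆P = proj₂ cs f λ xs →
    let (g , Gg , agree) = meets xs in g , Gg P cs aut⊆P F⊆P , agree

  G-≈ : ∀ {f f'} → f ≈P f' → G f → G f'
  G-≈ {f} {f'} f≈f' Gf = G-closed f' λ xs → f , Gf , universal f≈f' xs

  G-conj-aut : ∀ β {p} → IsAut E β → G p → G (conjBy β p)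
  G-conj-aut β β-aut Gp = G-∘ (G-⁻¹ (G-aut β β-aut)) (G-∘ Gp (G-aut β β-aut))

  induction : ExcludedMiddle (Level.suc 0ℓ) → (Q : Perm D → Set₁) → IsClosedSubgroup₁ Q →
    (∀ α → IsAut E α → Q α) → (∀ h → F h → Q h) → ∀ f → G f → Q f
  induction lem Q ((Qid , Q∘ , Q⁻¹) , Qclosed) aut⊆Q F⊆Q f Gf =
    raise lem (Gf P P-closed-subgroup (λ α α-aut → lower lem (aut⊆Q α α-aut))
                                      (λ h Fh → lower lem (F⊆Q h Fh)))
    where
    P : Perm D → Set
    P g = Lower (lem {Q g})
    P-closed-subgroup : IsClosedSubgroup P
    P-closed-subgroup =
      ( lower lem Qid
      , (λ f g Pf Pg → lower lem (Q∘ f g (raise lem Pf) (raise lem Pg)))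
      , (λ f Pf → lower lem (Q⁻¹ f (raise lem Pf))) )
      , λ f meets → lower lem (Qclosed f λ xs →
          let (g , Pg , agree) = meets xs in g , raise lem Pg , agree)

  same-type : (∀ x → ¬ E x x) → ∀ {p q} → G q →
    (∀ x y → x ≢ y → E (to p x) (to p y) ⇔ E (to q x) (to q y)) → G p
  same-type irr {p} {q} Gq same =
    G-≈ (λ x → cong (to p) (from-to q x)) (G-∘ (G-aut (p ∘P (q ⁻¹P)) (same-type-aut irr p q same)) Gq)

⟨⟩-mono : {D : Set} (E : D → D → Set) {F F' : Perm D → Set} →
  (∀ h → F h → F' h) → ∀ f → ⟨ E ⟩ F f → ⟨ E ⟩ F' f
⟨⟩-mono E F⊆F' f Gf P cs aut⊆P F'⊆P = Gf P cs aut⊆P (λ h Fh → F'⊆P h (F⊆F' h Fh))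

module AdjoinAntiAutomorphism (lem : ExcludedMiddle (Level.suc 0ℓ)) {D : Set} (E : D → D → Set)
  (m : Perm D) (m-anti : IsMinus E m) (F : Perm D → Set)
  (F-normal : ∀ h → F h → ⟨ E ⟩ F (conjBy m h)) where
  open Edges E
  open Generated E F
  module G± = Generated E (λ h → h ≈P m ⊎ F h)

  -- ⟨ F ⟩ is normalised by m: conjugation by m is a homeomorphic
  -- automorphism of Sym(D) preserving Aut and sending F into ⟨ F ⟩.
  normal : ∀ g → G g → G (conjBy m g)
  normal = induction lem (λ g → G (conjBy m g)) closed-subgroup
    (λ α α-aut → G-aut (conjBy m α) (anti-conj-aut m α m-anti α-aut)) F-normal
    where
    closed-subgroup : IsClosedSubgroup₁ (λ g → G (conjBy m g))
    closed-subgroup =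
      ( G-≈ (λ x → sym (from-to m x)) G-id
      , (λ f g Gf Gg → G-≈ (λ x → cong (λ y → from m (to f y)) (to-from m (to g (to m x)))) (G-∘ Gf Gg))
      , (λ f Gf → G-≈ (λ x → refl) (G-⁻¹ Gf)) )
      , λ f meets → G-closed (conjBy m f) λ xs →
          let (g , Gg , agree) = meets (map (to m) xs)
          in conjBy m g , Gg , All.map (cong (from m)) (map⁻ agree)

  m∘m∈G : G (m ∘P m)
  m∘m∈G = G-aut (m ∘P m) (anti²-aut m m-anti)

  G∪mG : Perm D → Set₁
  G∪mG f = G f ⊎ G ((m ⁻¹P) ∘P f)

  ∪-∘ : ∀ f g → G∪mG f → G∪mG g → G∪mG (f ∘P g)
  ∪-∘ f g (inj₁ Gf) (inj₁ Gg) = inj₁ (G-∘ Gf Gg)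
  ∪-∘ f g (inj₁ Gf) (inj₂ Gm⁻¹g) =
    inj₂ (G-≈ (λ x → cong (λ y → from m (to f y)) (to-from m (to g x))) (G-∘ (normal f Gf) Gm⁻¹g))
  ∪-∘ f g (inj₂ Gm⁻¹f) (inj₁ Gg) = inj₂ (G-≈ (λ x → refl) (G-∘ Gm⁻¹f Gg))
  ∪-∘ f g (inj₂ Gm⁻¹f) (inj₂ Gm⁻¹g) =
    inj₁ (G-≈ cancel (G-∘ m∘m∈G (G-∘ (normal ((m ⁻¹P) ∘P f) Gm⁻¹f) Gm⁻¹g)))
    where
    -- f g = m² (m⁻¹ (m⁻¹ f) m) (m⁻¹ g)
    cancel : ((m ∘P m) ∘P (conjBy m ((m ⁻¹P) ∘P f) ∘P ((m ⁻¹P) ∘P g))) ≈P (f ∘P g)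
    cancel x = begin
      to (m ∘P m) (from (m ∘P m) (to f (to m (from m (to g x))))) ≡⟨ to-from (m ∘P m) _ ⟩
      to f (to m (from m (to g x)))                              ≡⟨ cong (to f) (to-from m (to g x)) ⟩
      to f (to g x)                                              ∎
      where open ≡-Reasoning

  ∪-⁻¹ : ∀ f → G∪mG f → G∪mG (f ⁻¹P)
  ∪-⁻¹ f (inj₁ Gf) = inj₁ (G-⁻¹ Gf)
  ∪-⁻¹ f (inj₂ Gm⁻¹f) =
    inj₂ (G-≈ (λ x → cong (λ y → from m (from f y)) (to-from (m ∘P m) x))
              (G-∘ (normal _ (G-⁻¹ Gm⁻¹f)) (G-⁻¹ m∘m∈G)))

  ∪-closed : IsClosed₁ G∪mG
  ∪-closed = union-closed lem G (λ f → G ((m ⁻¹P) ∘P f)) G-closed λ f meets →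
    G-closed ((m ⁻¹P) ∘P f) λ xs →
      let (g , Gm⁻¹g , agree) = meets xs in (m ⁻¹P) ∘P g , Gm⁻¹g , All.map (cong (from m)) agree

  ∪-gen : ∀ h → h ≈P m ⊎ F h → G∪mG h
  ∪-gen h (inj₁ h≈m) = inj₂ (G-≈ (λ x → trans (sym (from-to m x)) (cong (from m) (sym (h≈m x)))) G-id)
  ∪-gen h (inj₂ Fh) = inj₁ (G-gen h Fh)

  ⟨m,F⟩⊆G∪mG : ∀ f → G±.G f → G∪mG f
  ⟨m,F⟩⊆G∪mG = G±.induction lem G∪mG ((inj₁ G-id , ∪-∘ , ∪-⁻¹) , ∪-closed)
    (λ α α-aut → inj₁ (G-aut α α-aut)) ∪-gen

  characterisation : ∀ f →
    (G±.G f → Σ (Perm D) λ g → G g × (f ≈P g ⊎ f ≈P (m ∘P g)))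
    × ((Σ (Perm D) λ g → G g × (f ≈P g ⊎ f ≈P (m ∘P g))) → G±.G f)
  characterisation f = (λ Gf → representative (⟨m,F⟩⊆G∪mG f Gf)) , generated
    where
    representative : G∪mG f → Σ (Perm D) λ g → G g × (f ≈P g ⊎ f ≈P (m ∘P g))
    representative (inj₁ Gf) = f , Gf , inj₁ (λ x → refl)
    representative (inj₂ Gm⁻¹f) = (m ⁻¹P) ∘P f , Gm⁻¹f , inj₂ (λ x → sym (to-from m (to f x)))
    F⊆G± : ∀ g → G g → G±.G g
    F⊆G± = ⟨⟩-mono E (λ h → inj₂)
    generated : (Σ (Perm D) λ g → G g × (f ≈P g ⊎ f ≈P (m ∘P g))) → G±.G f
    generated (g , Gg , inj₁ f≈g) = G±.G-≈ (λ x → sym (f≈g x)) (F⊆G± g Gg)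
    generated (g , Gg , inj₂ f≈mg) =
      G±.G-≈ (λ x → sym (f≈mg x)) (G±.G-∘ (G±.G-gen m (inj₁ (λ x → refl))) (F⊆G± g Gg))

record AlteredAt {D : Set} (E : D → D → Set) (b : D) (p : Perm D) (Out In : D → Set) : Set where
  field
    away : ∀ x y → x ≢ b → y ≢ b → x ≢ y → E (to p x) (to p y) ⇔ E x y
    out  : ∀ y → y ≢ b → E (to p b) (to p y) ⇔ Out y
    into : ∀ x → x ≢ b → E (to p x) (to p b) ⇔ In x

module Altered {D : Set} (E : D → D → Set) where
  open Edges E
  open AlteredAt

  IsSwitchAt : D → Perm D → Set
  IsSwitchAt b p = AlteredAt E b p (λ y → E y b) (E b)

  IsCounterRotationAt : D → Perm D → Set
  IsCounterRotationAt b p = AlteredAt E b p (λ y → E y b) (λ x → N E x b)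

  altered-same-type : ExcludedMiddle 0ℓ → ∀ {b p q Out In} →
    AlteredAt E b p Out In → AlteredAt E b q Out In →
    ∀ x y → x ≢ y → E (to p x) (to p y) ⇔ E (to q x) (to q y)
  altered-same-type lem {b} P Q x y x≢y with lem {x ≡ b} | lem {y ≡ b}
  ... | yes refl | yes refl = ⊥-elim (x≢y refl)
  ... | yes refl | no y≢b = ⇔-trans (out P y y≢b) (⇔-sym (out Q y y≢b))
  ... | no x≢b | yes refl = ⇔-trans (into P x x≢b) (⇔-sym (into Q x x≢b))
  ... | no x≢b | no y≢b = ⇔-trans (away P x y x≢b y≢b x≢y) (⇔-sym (away Q x y x≢b y≢b x≢y))

  altered-cong : ∀ {b p Out In Out' In'} → AlteredAt E b p Out In →
    (∀ y → Out y ⇔ Out' y) → (∀ x → In x ⇔ In' x) → AlteredAt E b p Out' In'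
  altered-cong P Out⇔ In⇔ = record
    { away = away P
    ; out  = λ y y≢b → ⇔-trans (out P y y≢b) (Out⇔ y)
    ; into = λ x x≢b → ⇔-trans (into P x x≢b) (In⇔ x) }

  altered-conj-aut : ∀ {b p Out In} (β : Perm D) → IsAut E β →
    AlteredAt E (to β b) p Out In → AlteredAt E b (conjBy β p) (λ y → Out (to β y)) (λ x → In (to β x))
  altered-conj-aut {b} {p} β β-aut P = record
    { away = λ x y x≢b y≢b x≢y →
        ⇔-trans (aut-inverse β β-aut _ _)
          (⇔-trans (away P (to β x) (to β y) (moved x≢b) (moved y≢b) (λ e → x≢y (to-injective β e)))
                   (⇔-sym (β-aut x y)))
    ; out  = λ y y≢b → ⇔-trans (aut-inverse β β-aut _ _) (out P (to β y) (moved y≢b))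
    ; into = λ x x≢b → ⇔-trans (aut-inverse β β-aut _ _) (into P (to β x) (moved x≢b)) }
    where
    moved : ∀ {x} → x ≢ b → to β x ≢ to β b
    moved = off-point β refl

  altered-conj-anti : ∀ {b p Out In} (m : Perm D) → IsMinus E m →
    AlteredAt E (to m b) p Out In → AlteredAt E b (conjBy m p) (λ y → In (to m y)) (λ x → Out (to m x))
  altered-conj-anti {b} {p} m m-anti P = record
    { away = λ x y x≢b y≢b x≢y →
        ⇔-trans (anti-inverse m m-anti _ _)
          (⇔-trans (away P (to m y) (to m x) (moved y≢b) (moved x≢b) (λ e → x≢y (sym (to-injective m e))))
                   (m-anti y x))
    ; out  = λ y y≢b → ⇔-trans (anti-inverse m m-anti _ _) (into P (to m y) (moved y≢b))
    ; into = λ x x≢b → ⇔-trans (anti-inverse m m-anti _ _) (out P (to m x) (moved x≢b)) }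
    where
    moved : ∀ {x} → x ≢ b → to m x ≢ to m b
    moved = off-point m refl

  switch-altered : ∀ {a s} → IsSw E a s → IsSwitchAt a s
  switch-altered {a} sw = record
    { away = λ x y x≢a y≢a x≢y → ⇔-trans (sw x y x≢y) (mk⇔
        (λ { (inj₁ (_ , _ , e)) → e
           ; (inj₂ (inj₁ x≡a , _)) → ⊥-elim (x≢a x≡a)
           ; (inj₂ (inj₂ y≡a , _)) → ⊥-elim (y≢a y≡a) })
        (λ e → inj₁ (x≢a , y≢a , e)))
    ; out = λ y y≢a → ⇔-trans (sw a y (λ a≡y → y≢a (sym a≡y))) (mk⇔
        (λ { (inj₁ (a≢a , _)) → ⊥-elim (a≢a refl) ; (inj₂ (_ , e)) → e })
        (λ e → inj₂ (inj₁ refl , e)))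
    ; into = λ x x≢a → ⇔-trans (sw x a x≢a) (mk⇔
        (λ { (inj₁ (_ , a≢a , _)) → ⊥-elim (a≢a refl) ; (inj₂ (_ , e)) → e })
        (λ e → inj₂ (inj₂ refl , e))) }

  rotation-altered : ∀ {a r} → IsRot E a r → AlteredAt E a r (N E a) (E a)
  rotation-altered {a} rot = record
    { away = λ x y x≢a y≢a x≢y → ⇔-trans (rot x y x≢y) (mk⇔
        (λ { (inj₁ (_ , _ , e)) → e
           ; (inj₂ (inj₁ (x≡a , _))) → ⊥-elim (x≢a x≡a)
           ; (inj₂ (inj₂ (y≡a , _))) → ⊥-elim (y≢a y≡a) })
        (λ e → inj₁ (x≢a , y≢a , e)))
    ; out = λ y y≢a → ⇔-trans (rot a y (λ a≡y → y≢a (sym a≡y))) (mk⇔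
        (λ { (inj₁ (a≢a , _)) → ⊥-elim (a≢a refl)
           ; (inj₂ (inj₁ (_ , n))) → n
           ; (inj₂ (inj₂ (y≡a , _))) → ⊥-elim (y≢a y≡a) })
        (λ n → inj₂ (inj₁ (refl , n))))
    ; into = λ x x≢a → ⇔-trans (rot x a x≢a) (mk⇔
        (λ { (inj₁ (_ , a≢a , _)) → ⊥-elim (a≢a refl)
           ; (inj₂ (inj₁ (x≡a , _))) → ⊥-elim (x≢a x≡a)
           ; (inj₂ (inj₂ (_ , e))) → e })
        (λ e → inj₂ (inj₂ (refl , e)))) }

  edge-by-exclusion : ExcludedMiddle 0ℓ → (∀ x y → E x y → ¬ E y x) →
    ∀ w a → E w a ⇔ (¬ E a w × ¬ N E a w)
  edge-by-exclusion lem asym w a = mk⇔ (λ e → asym w a e , (λ n → proj₂ n e)) decide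
    where
    decide : ¬ E a w × ¬ N E a w → E w a
    decide (¬aw , ¬n) with lem {E w a}
    ... | yes wa = wa
    ... | no ¬wa = ⊥-elim (¬n (¬aw , ¬wa))

  inverse-rotation-altered : ExcludedMiddle 0ℓ → (∀ x y → E x y → ¬ E y x) →
    ∀ {a r} → IsRot E a r → IsCounterRotationAt (to r a) (r ⁻¹P)
  inverse-rotation-altered lem asym {a} {r} rot = record
    { away = λ u v u≢ra v≢ra u≢v →
        ⇔-trans (⇔-sym (away R (from r u) (from r v) (moved u≢ra) (moved v≢ra)
                                (λ e → u≢v (from-injective r e))))
                (E-cong (to-from r u) (to-from r v))
    ; out = λ v v≢ra → begin
        E (from r (to r a)) (from r v)  ∼⟨ E-cong (from-to r a) refl ⟩
        E a (from r v)                  ∼⟨ ⇔-sym (into R (from r v) (moved v≢ra)) ⟩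
        E (to r (from r v)) (to r a)    ∼⟨ E-cong (to-from r v) refl ⟩
        E v (to r a)                    ∎
    ; into = λ u u≢ra → begin
        E (from r u) (from r (to r a))          ∼⟨ E-cong refl (from-to r a) ⟩
        E (from r u) a                          ∼⟨ edge-by-exclusion lem asym (from r u) a ⟩
        (¬ E a (from r u) × ¬ N E a (from r u)) ∼⟨ ¬-cong-⇔ (⇔-sym (into R _ (moved u≢ra)))
                                                   ×-⇔ ¬-cong-⇔ (⇔-sym (out R _ (moved u≢ra))) ⟩
        N E (to r (from r u)) (to r a)          ∼⟨ N-cong (E-cong (to-from r u) refl) (E-cong refl (to-from r u)) ⟩
        N E u (to r a)                          ∎ }
    where
    open ⇔-Reasoning
    R : AlteredAt E a r (N E a) (E a)
    R = rotation-altered rot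
    moved : ∀ {u} → u ≢ to r a → from r u ≢ a
    moved = off-point (r ⁻¹P) (from-to r a)

  switch-conj-anti : ∀ {a b s} (m : Perm D) → IsMinus E m → to m b ≡ a → IsSw E a s →
    IsSwitchAt b (conjBy m s)
  switch-conj-anti {b = b} {s} m m-anti refl sw =
    altered-cong (altered-conj-anti {p = s} m m-anti (switch-altered sw)) (λ y → m-anti b y) (λ x → m-anti x b)

  switch-conj-aut : ∀ {a b s} (β : Perm D) → IsAut E β → to β b ≡ a → IsSw E a s →
    IsSwitchAt b (conjBy β s)
  switch-conj-aut {b = b} {s} β β-aut refl sw =
    altered-cong (altered-conj-aut {p = s} β β-aut (switch-altered sw))
                 (λ y → ⇔-sym (β-aut y b)) (λ x → ⇔-sym (β-aut b x))

  rotation-conj-anti : ∀ {a b r} (m : Perm D) → IsMinus E m → to m b ≡ a → IsRot E a r →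
    IsCounterRotationAt b (conjBy m r)
  rotation-conj-anti {b = b} {r} m m-anti refl rot =
    altered-cong (altered-conj-anti {p = r} m m-anti (rotation-altered rot))
                 (λ y → m-anti b y) (λ x → N-cong (m-anti b x) (m-anti x b))

  counter-rotation-conj-aut : ∀ {a b p} (β : Perm D) → IsAut E β → to β b ≡ a →
    IsCounterRotationAt a p → IsCounterRotationAt b (conjBy β p)
  counter-rotation-conj-aut {b = b} {p = p} β β-aut refl C =
    altered-cong (altered-conj-aut {p = p} β β-aut C)
                 (λ y → ⇔-sym (β-aut y b)) (λ x → N-cong (⇔-sym (β-aut x b)) (⇔-sym (β-aut b x)))

module GenericDigraph (lem : ExcludedMiddle 0ℓ) {D : Set} (E : D → D → Set)
  (generic : IsGenericDigraph E) where
  open Altered E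

  irreflexive : ∀ x → ¬ E x x
  irreflexive = proj₁ (proj₁ (proj₂ generic))

  asymmetric : ∀ x y → E x y → ¬ E y x
  asymmetric = proj₂ (proj₁ (proj₂ generic))

  -- Homogeneity for one-point substructures: Aut is transitive on D.
  transitive : ∀ b a → Σ (Perm D) λ β → IsAut E β × to β b ≡ a
  transitive b a =
    let (β , β-aut , β-maps) = proj₁ (proj₂ (proj₂ generic)) 1 (λ _ → b) (λ _ → a)
          (λ { {zero} {zero} _ → refl }) (λ { {zero} {zero} _ → refl })
          (λ _ _ → mk⇔ (λ e → ⊥-elim (irreflexive b e)) (λ e → ⊥-elim (irreflexive a e)))
    in β , β-aut , β-maps zero

  generator-normal : ∀ (m s : Perm D) → ⟨ E ⟩ (λ h → h ≈P s) (conjBy m s) →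
    ∀ h → h ≈P s → ⟨ E ⟩ (λ h → h ≈P s) (conjBy m h)
  generator-normal m s conj h h≈s = G-≈ (λ x → cong (from m) (sym (h≈s (to m x)))) conj
    where open Generated E (λ h → h ≈P s)

  -- m⁻¹ sw m and β⁻¹ sw β are both switches at m⁻¹ a.
  switch-normal : ∀ {a s} (m : Perm D) → IsMinus E m → IsSw E a s →
    ∀ h → h ≈P s → ⟨ E ⟩ (λ h → h ≈P s) (conjBy m h)
  switch-normal {a} {s} m m-anti sw =
    let (β , β-aut , β-maps) = transitive (from m a) a
    in generator-normal m s (same-type irreflexive {conjBy m s} (G-conj-aut β β-aut (G-gen s (λ x → refl)))
         (altered-same-type lem (switch-conj-anti {s = s} m m-anti (to-from m a) sw)
                                (switch-conj-aut {s = s} β β-aut β-maps sw)))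
    where open Generated E (λ h → h ≈P s)

  -- m⁻¹ rot m and β⁻¹ rot⁻¹ β (with β m⁻¹ a = rot a) are both counter-rotations
  -- at m⁻¹ a.
  rotation-normal : ∀ {a r} (m : Perm D) → IsMinus E m → IsRot E a r →
    ∀ h → h ≈P r → ⟨ E ⟩ (λ h → h ≈P r) (conjBy m h)
  rotation-normal {a} {r} m m-anti rot =
    let (β , β-aut , β-maps) = transitive (from m a) (to r a)
    in generator-normal m r (same-type irreflexive {conjBy m r} (G-conj-aut β β-aut (G-⁻¹ (G-gen r (λ x → refl))))
         (altered-same-type lem (rotation-conj-anti {r = r} m m-anti (to-from m a) rot)
           (counter-rotation-conj-aut {p = r ⁻¹P} β β-aut β-maps (inverse-rotation-altered lem asymmetric {r = r} rot))))
    where open Generated E (λ h → h ≈P r)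

mainTheorem8 : ExcludedMiddle 0ℓ → ExcludedMiddle (Level.suc 0ℓ) →
    (D : Set) (E : D → D → Set) → IsGenericDigraph E →
    (minus : Perm D) → IsMinus E minus →
    ((a : D) (sw : Perm D) → IsSw E a sw → ∀ f →
      (⟨ E ⟩ (λ h → h ≈P minus ⊎ h ≈P sw) f →
         Σ (Perm D) λ g → ⟨ E ⟩ (λ h → h ≈P sw) g × (f ≈P g ⊎ f ≈P (minus ∘P g)))
      × ((Σ (Perm D) λ g → ⟨ E ⟩ (λ h → h ≈P sw) g × (f ≈P g ⊎ f ≈P (minus ∘P g))) →
         ⟨ E ⟩ (λ h → h ≈P minus ⊎ h ≈P sw) f))
    ×
    ((a : D) (rot : Perm D) → IsRot E a rot → ∀ f →
      (⟨ E ⟩ (λ h → h ≈P minus ⊎ h ≈P rot) f →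
         Σ (Perm D) λ g → ⟨ E ⟩ (λ h → h ≈P rot) g × (f ≈P g ⊎ f ≈P (minus ∘P g)))
      × ((Σ (Perm D) λ g → ⟨ E ⟩ (λ h → h ≈P rot) g × (f ≈P g ⊎ f ≈P (minus ∘P g))) →
         ⟨ E ⟩ (λ h → h ≈P minus ⊎ h ≈P rot) f))
mainTheorem8 lem0 lem1 D E generic minus minus-anti =
    (λ a sw is-sw → Adjoin.characterisation minus minus-anti (λ h → h ≈P sw)
                      (switch-normal {s = sw} minus minus-anti is-sw))
  , (λ a rot is-rot → Adjoin.characterisation minus minus-anti (λ h → h ≈P rot)
                      (rotation-normal {r = rot} minus minus-anti is-rot))
  where
  open GenericDigraph lem0 E generic
  module Adjoin = AdjoinAntiAutomorphism lem1 E
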